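{- Let $\Sigma$ be a finite alphabet, $r\ge 0$, and let $A$ be a $\Sigma_{r+1}$-tree automaton with $m$ states. Let $\mathcal{T}$ be a $\Sigma$-tree with node set $T$, and let $Y\subseteq T$ have at least $2m^m+2$ elements. Then, with $n=\lfloor |Y|/(4m^m+4)\rfloor$, there exist pairwise disjoint sets of nodes $V_1,\ldots,V_n\subseteq T$ and, for each $i\in\{1,\ldots,n\}$, a pair $(b_i,b_i')\in (V_i\cap Y)^2$ of distinct nodes, such that: for every $\overline{a}=\langle a_1,\ldots,a_r\rangle\in T^r$ and every $i\in\{1,\ldots,n\}$, if $\{a_1,\ldots,a_r\}\cap V_i=\emptyset$, then the runs of $A$ on $\mathcal{T}_{\overline{a}b_i}$ and on $\mathcal{T}_{\overline{a}b_i'}$ label the root of the tree with the same state.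
   Context: A binary tree has a set of nodes $T$, a left-child relation $S_1$ and a right-child relation $S_2$ (each node has at most one left and at most one right child), and the tree order $\preceq$ (transitive closure of $S_1\cup S_2$). A $\Sigma$-tree is a binary tree in which every node $v$ carries exactly one label $\sigma^{\mathcal{T}}(v)\in\Sigma$. For $k\ge1$, $\Sigma_k=\Sigma\times\{0,1\}^k$. If $\mathcal{T}$ is a $\Sigma$-tree and $\overline{v}=\langle v_1,\ldots,v_k\rangle$ are nodes (pebbles $1,\ldots,k$ placed on them), $\mathcal{T}_{\overline{v}}$ is the $\Sigma_k$-tree with the same underlying tree and labels $\sigma^{\mathcal{T}_{\overline{v}}}(u)=(\sigma^{\mathcal{T}}(u),\alpha_1,\ldots,\alpha_k)$ where $\alpha_i=1$ iff $u=v_i$. A $\Sigma$-tree automaton is $A=(Q,\delta,F)$ with finite state set $Q$, accepting states $F\subseteq Q$ and transition function $\delta:(Q\cup\{*\})^2\times\Sigma\to Q$ ($*\notin Q$). The run of $A$ on a $\Sigma$-tree is the function $\rho:T\to Q$ with $\rho(v)=\delta(\rho'(u_1),\rho'(u_2),\sigma(v))$, where $\rho'(u_1)$ is the state of the left child of $v$ (or $*$ if there is none) and $\rho'(u_2)$ that of the right child (or $*$ if none). The number of states of $A$ is $|Q|$. -}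

module Defs where

open import Data.Nat using (ℕ; suc; _+_)
open import Data.Fin using (Fin)
open import Data.Bool using (Bool; true; false)
open import Data.Maybe using (Maybe; just; nothing)
open import Data.Product using (_×_; _,_)
open import Data.Vec using (Vec; map)
open import Relation.Nullary using (Dec; yes; no; ¬_)
open import Relation.Nullary.Decidable using (isYes)
open import Relation.Binary.PropositionalEquality using (_≡_; refl)

mutual
  data Tree (A : Set) : Set where
    node : A → Child A → Child A → Tree A

  data Child (A : Set) : Set where
    none : Child A
    some : Tree A → Child A

-- The node set T of a tree: positions (paths from the root).
mutual
  data Pos {A : Set} : Tree A → Set where
    here : ∀ {a l r} → Pos (node a l r)
    goL  : ∀ {a l r} → CPos l → Pos (node a l r)
    goR  : ∀ {a l r} → CPos r → Pos (node a l r)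

  data CPos {A : Set} : Child A → Set where
    inside : ∀ {t} → Pos t → CPos (some t)

mutual
  _≟P_ : {A : Set} {t : Tree A} → (u v : Pos t) → Dec (u ≡ v)
  here  ≟P here  = yes refl
  here  ≟P goL _ = no λ ()
  here  ≟P goR _ = no λ ()
  goL _ ≟P here  = no λ ()
  goL p ≟P goL q with p ≟C q
  ... | yes refl = yes refl
  ... | no ne    = no λ { refl → ne refl }
  goL _ ≟P goR _ = no λ ()
  goR _ ≟P here  = no λ ()
  goR _ ≟P goL _ = no λ ()
  goR p ≟P goR q with p ≟C q
  ... | yes refl = yes refl
  ... | no ne    = no λ { refl → ne refl }

  _≟C_ : {A : Set} {c : Child A} → (u v : CPos c) → Dec (u ≡ v)
  inside p ≟C inside q with p ≟P q
  ... | yes refl = yes refl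
  ... | no ne    = no λ { refl → ne refl }

mutual
  relabel : {A B : Set} (t : Tree A) → (Pos t → A → B) → Tree B
  relabel (node a l r) f =
    node (f here a) (relabelC l (λ p → f (goL p))) (relabelC r (λ p → f (goR p)))

  relabelC : {A B : Set} (c : Child A) → (CPos c → A → B) → Child B
  relabelC none     f = none
  relabelC (some t) f = some (relabel t (λ p → f (inside p)))

Σ[_] : Set → ℕ → Set
Σ[ S ] k = S × Vec Bool k

pebble : {S : Set} {k : ℕ} (t : Tree S) → Vec (Pos t) k → Tree (Σ[ S ] k)
pebble t vs = relabel t (λ u a → a , map (λ v → isYes (u ≟P v)) vs)

-- Tree automaton over alphabet S with state set Fin m.
-- nothing plays the role of * (no child).
record Automaton (S : Set) (m : ℕ) : Set where
  field
    δ : Maybe (Fin m) → Maybe (Fin m) → S → Fin m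
    F : Fin m → Bool

mutual
  runRoot : {S : Set} {m : ℕ} → Automaton S m → Tree S → Fin m
  runRoot A (node a l r) = Automaton.δ A (runC A l) (runC A r) a

  runC : {S : Set} {m : ℕ} → Automaton S m → Child S → Maybe (Fin m)
  runC A none     = nothing
  runC A (some t) = just (runRoot A t)

module Submission where

-- A part is a region of the tree (the subtree at a node v, minus the subtree at
-- an optional hole h below v) with two distinct nodes b, b′ of Y in it that
-- act alike: with only the last pebble on b resp. b′, the state reached at v
-- is the same function of the state at h.  Runs are compositional
-- (run-split), so a region talks to the rest of the tree only through the
-- states at v and h; hence if the other r pebbles avoid the region, moving the
-- last pebble from b to b′ leaves the state at the root unchanged (swap-twins).
--
-- Parts are found greedily bottom-up (decompose): at each node the
-- decompositions of both sides are merged, and once K = m^m + 1 nodes of Y are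
-- pending above the current hole, two of them induce the same function
-- Fin m → Fin m (pigeonhole); they form a new part whose root becomes the new
-- hole.  An amortised budget (a hole carries credit 2K, a part costs 4K) shows
-- that at least |Y| / 4K parts are produced (enough-parts), and lemma4 takes
-- the first n of them.

open import Defs
open import Data.Nat using (ℕ; suc; _+_; _*_; _^_; _≤_)
open import Data.Nat.DivMod using (_/_)
open import Data.Fin using (Fin)
open import Data.Bool using (Bool; true; false)
open import Data.Vec using (Vec; lookup; _∷ʳ_)
open import Data.List using (List; length)
open import Data.List.Relation.Unary.Unique.Propositional using (Unique)
open import Data.List.Membership.Propositional using (_∈_)
open import Data.Product using (Σ; _×_; _,_; ∃)
open import Data.Empty using (⊥)
open import Relation.Binary.PropositionalEquality using (_≡_; _≢_)

open import Data.Nat using (_<_; z≤n; s≤s; _≤?_)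
open import Data.Nat.Properties using (≰⇒>; +-suc; +-identityʳ; ≤-pred; ≤-trans; m≤m+n)
open import Data.Nat.DivMod using (m<n*o⇒m/o<n)
open import Data.Nat.Tactic.RingSolver using (solve-∀)
open import Data.Fin using (funToFin; finToFun; inject≤)
open import Data.Fin.Properties using (finToFun-funToFin; inject≤-injective)
open import Data.Bool using (not)
open import Data.Maybe using (Maybe; just; nothing; is-just; maybe)
import Data.Maybe as Maybe
open import Data.Vec using (replicate; []; _∷_)
import Data.Vec as Vec
open import Data.Vec.Properties using (map-∷ʳ)
open import Data.List using ([]; _∷_; _++_; map; mapMaybe; filter)
import Data.List as List
open import Data.List.Properties using (length-++; length-map)
open import Data.List.Relation.Unary.All as All using (All; []; _∷_)
import Data.List.Relation.Unary.All.Properties as All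
open import Data.List.Relation.Unary.AllPairs as AllPairs using (AllPairs; []; _∷_)
import Data.List.Relation.Unary.AllPairs.Properties as AllPairs
import Data.List.Relation.Unary.Unique.Propositional.Properties as Unique
open import Data.List.Membership.Propositional.Properties using (∈-filter⁻; ∈-lookup)
open import Data.Product using (proj₁; proj₂)
open import Data.Unit using (⊤; tt)
open import Data.Empty using (⊥-elim)
open import Function using (_∘_; _∘′_)
open import Relation.Nullary using (Dec; yes; no)
open import Relation.Nullary.Decidable using (isYes)
open import Relation.Binary.PropositionalEquality

module _ {S : Set} where

  subtree : (t : Tree S) → Pos t → Tree S
  subtree (node a l r)        here             = node a l r
  subtree (node a (some l) r) (goL (inside v)) = subtree l v
  subtree (node a l (some r)) (goR (inside v)) = subtree r v

  embed : {t : Tree S} (v : Pos t) → Pos (subtree t v) → Pos t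
  embed {node a l r}        here             p = p
  embed {node a (some l) r} (goL (inside v)) p = goL (inside (embed v p))
  embed {node a l (some r)} (goR (inside v)) p = goR (inside (embed v p))

  locate : {t : Tree S} (v u : Pos t) → Maybe (Pos (subtree t v))
  locate {node a l r}        here             u                = just u
  locate {node a (some l) r} (goL (inside v)) (goL (inside u)) = locate v u
  locate {node a (some l) r} (goL (inside v)) here             = nothing
  locate {node a (some l) r} (goL (inside v)) (goR _)          = nothing
  locate {node a l (some r)} (goR (inside v)) (goR (inside u)) = locate v u
  locate {node a l (some r)} (goR (inside v)) here             = nothing
  locate {node a l (some r)} (goR (inside v)) (goL _)          = nothing

  locate-embed : {t : Tree S} (v : Pos t) (p : Pos (subtree t v)) → locate v (embed v p) ≡ just p
  locate-embed {node a l r}        here             p = refl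
  locate-embed {node a (some l) r} (goL (inside v)) p = locate-embed v p
  locate-embed {node a l (some r)} (goR (inside v)) p = locate-embed v p

  embed-injective : {t : Tree S} (v : Pos t) {p q : Pos (subtree t v)} → embed v p ≡ embed v q → p ≡ q
  embed-injective v {p} {q} e = just-injective (begin
      just p               ≡⟨ locate-embed v p ⟨
      locate v (embed v p) ≡⟨ cong (locate v) e ⟩
      locate v (embed v q) ≡⟨ locate-embed v q ⟩
      just q               ∎)
    where
    open ≡-Reasoning
    just-injective : {X : Set} {x y : X} → just x ≡ just y → x ≡ y
    just-injective refl = refl

  below : {t : Tree S} → Maybe (Pos t) → Pos t → Bool
  below nothing  u = false
  below (just h) u = is-just (locate h u)

  below-embed : {t : Tree S} (h : Pos t) (p : Pos (subtree t h)) → below (just h) (embed h p) ≡ true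
  below-embed h p rewrite locate-embed h p = refl

  region : {t : Tree S} (v : Pos t) → Maybe (Pos (subtree t v)) → Pos t → Bool
  region v hole u = maybe (λ p → not (below hole p)) false (locate v u)

  region-embed : {t : Tree S} (v : Pos t) (hole : Maybe (Pos (subtree t v))) (p : Pos (subtree t v)) →
                 region v hole (embed v p) ≡ not (below hole p)
  region-embed v hole p rewrite locate-embed v p = refl

module Runs {S B : Set} {m : ℕ} (A : Automaton B m) where
  open Automaton A using (δ)

  cong-δ : ∀ {l l′ r r′ x x′} → l ≡ l′ → r ≡ r′ → x ≡ x′ → δ l r x ≡ δ l′ r′ x′
  cong-δ refl refl refl = refl

  run : (t : Tree S) → (Pos t → S → B) → Fin m
  run t f = runRoot A (relabel t f)

  mutual
    run-cong : (t : Tree S) (f g : Pos t → S → B) → (∀ u x → f u x ≡ g u x) → run t f ≡ run t g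
    run-cong (node a l r) f g e =
      cong-δ (runC-cong l _ _ (λ u → e (goL u))) (runC-cong r _ _ (λ u → e (goR u))) (e here a)

    runC-cong : (c : Child S) (f g : CPos c → S → B) → (∀ u x → f u x ≡ g u x) →
                runC A (relabelC c f) ≡ runC A (relabelC c g)
    runC-cong none     f g e = refl
    runC-cong (some t) f g e = cong just (run-cong t _ _ (λ u → e (inside u)))

  plug : (t : Tree S) → (Pos t → S → B) → Pos t → Fin m → Fin m
  plug (node a l r) f here q = q
  plug (node a (some l) r) f (goL (inside h)) q =
    δ (just (plug l (λ p → f (goL (inside p))) h q)) (runC A (relabelC r (λ p → f (goR p)))) (f here a)
  plug (node a l (some r)) f (goR (inside h)) q =
    δ (runC A (relabelC l (λ p → f (goL p)))) (just (plug r (λ p → f (goR (inside p))) h q)) (f here a)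

  run-split : (t : Tree S) (f : Pos t → S → B) (h : Pos t) →
              run t f ≡ plug t f h (run (subtree t h) (λ p → f (embed h p)))
  run-split (node a l r)        f here             = refl
  run-split (node a (some l) r) f (goL (inside h)) = cong (λ x → δ (just x) _ _) (run-split l _ h)
  run-split (node a l (some r)) f (goR (inside h)) = cong (λ x → δ _ (just x) _) (run-split r _ h)

  plug-cong : (t : Tree S) (f g : Pos t → S → B) (h : Pos t) (q : Fin m) →
              (∀ u → below (just h) u ≡ false → ∀ x → f u x ≡ g u x) → plug t f h q ≡ plug t g h q
  plug-cong (node a l r) f g here q e = refl
  plug-cong (node a (some l) r) f g (goL (inside h)) q e =
    cong-δ (cong just (plug-cong l _ _ h q (λ u → e (goL (inside u)))))
            (runC-cong r _ _ (λ u → e (goR u) refl)) (e here refl a)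
  plug-cong (node a l (some r)) f g (goR (inside h)) q e =
    cong-δ (runC-cong l _ _ (λ u → e (goL u) refl))
            (cong just (plug-cong r _ _ h q (λ u → e (goR (inside u))))) (e here refl a)

  behaviour : (t : Tree S) → (Pos t → S → B) → Maybe (Pos t) → Fin m → Fin m
  behaviour t f nothing  q = run t f
  behaviour t f (just h) q = plug t f h q

  behaviour-cong : (t : Tree S) (f g : Pos t → S → B) (hole : Maybe (Pos t)) (q : Fin m) →
                   (∀ u → below hole u ≡ false → ∀ x → f u x ≡ g u x) →
                   behaviour t f hole q ≡ behaviour t g hole q
  behaviour-cong t f g nothing  q e = run-cong t f g (λ u → e u refl)
  behaviour-cong t f g (just h) q e = plug-cong t f g h q e

  run-by-behaviour : (t : Tree S) (hole : Maybe (Pos t)) (f g : Pos t → S → B) →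
                     (∀ u → below hole u ≡ true → ∀ x → f u x ≡ g u x) →
                     (∀ q → behaviour t f hole q ≡ behaviour t g hole q) → run t f ≡ run t g
  run-by-behaviour t nothing f g inner same = same (run t f)
  run-by-behaviour t (just h) f g inner same = begin
    run t f                                          ≡⟨ run-split t f h ⟩
    plug t f h (run (subtree t h) (λ p → f (embed h p))) ≡⟨ cong (plug t f h) inner-same ⟩
    plug t f h (run (subtree t h) (λ p → g (embed h p))) ≡⟨ same _ ⟩
    plug t g h (run (subtree t h) (λ p → g (embed h p))) ≡⟨ run-split t g h ⟨
    run t g                                          ∎
    where
    open ≡-Reasoning
    inner-same : run (subtree t h) (λ p → f (embed h p)) ≡ run (subtree t h) (λ p → g (embed h p))
    inner-same = run-cong (subtree t h) _ _ (λ p → inner (embed h p) (below-embed h p))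

  run-local : (t : Tree S) (v : Pos t) (hole : Maybe (Pos (subtree t v))) (f g : Pos t → S → B) →
              (∀ u → region v hole u ≡ false → ∀ x → f u x ≡ g u x) →
              (∀ q → behaviour (subtree t v) (λ p → f (embed v p)) hole q
                   ≡ behaviour (subtree t v) (λ p → g (embed v p)) hole q) →
              run t f ≡ run t g
  run-local t v hole f g outside same = begin
    run t f                                           ≡⟨ run-split t f v ⟩
    plug t f v (run (subtree t v) (λ p → f (embed v p))) ≡⟨ cong (plug t f v) inside-same ⟩
    plug t f v (run (subtree t v) (λ p → g (embed v p))) ≡⟨ plug-cong t f g v _ outside-v ⟩
    plug t g v (run (subtree t v) (λ p → g (embed v p))) ≡⟨ run-split t g v ⟨
    run t g                                           ∎
    where
    open ≡-Reasoning
    inside-same : run (subtree t v) (λ p → f (embed v p)) ≡ run (subtree t v) (λ p → g (embed v p))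
    inside-same = run-by-behaviour (subtree t v) hole _ _
      (λ p e → outside (embed v p) (trans (region-embed v hole p) (cong not e))) same
    outside-v : ∀ u → below (just v) u ≡ false → ∀ x → f u x ≡ g u x
    outside-v u e = outside u (unlocated (locate v u) e)
      where
      unlocated : (mp : Maybe (Pos (subtree t v))) → is-just mp ≡ false →
                  maybe (λ p → not (below hole p)) false mp ≡ false
      unlocated nothing _ = refl

module _ {S : Set} {t : Tree S} where

  isYes-≢ : (u w : Pos t) → u ≢ w → isYes (u ≟P w) ≡ false
  isYes-≢ u w u≢w with u ≟P w
  ... | yes u≡w = ⊥-elim (u≢w u≡w)
  ... | no  _   = refl

  isYes-refl : (u : Pos t) → isYes (u ≟P u) ≡ true
  isYes-refl u with u ≟P u
  ... | yes _   = refl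
  ... | no  u≢u = ⊥-elim (u≢u refl)

  no-pebbles : {n : ℕ} (u : Pos t) (a : Vec (Pos t) n) → (∀ k → u ≢ lookup a k) →
               Vec.map (λ w → isYes (u ≟P w)) a ≡ replicate n false
  no-pebbles u []      avoid = refl
  no-pebbles u (w ∷ a) avoid =
    cong₂ _∷_ (isYes-≢ u w (avoid Data.Fin.zero)) (no-pebbles u a (λ k → avoid (Data.Fin.suc k)))

module Twins {S : Set} {r m : ℕ} (A : Automaton (Σ[ S ] (suc r)) m) where
  open Runs {S = S} A

  lastPebble : {t : Tree S} → Pos t → Pos t → S → Σ[ S ] (suc r)
  lastPebble b u x = x , replicate r false ∷ʳ isYes (u ≟P b)

  record TwinRegion (t : Tree S) : Set where
    field
      hole           : Maybe (Pos t)
      b b′           : Pos t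
      b-outside      : below hole b ≡ false
      b′-outside     : below hole b′ ≡ false
      distinct       : b ≢ b′
      same-behaviour : ∀ q → behaviour t (lastPebble b) hole q ≡ behaviour t (lastPebble b′) hole q

  Part : Tree S → Set
  Part t = Σ (Pos t) (λ v → TwinRegion (subtree t v))

  member : {t : Tree S} → Part t → Pos t → Bool
  member (v , R) = region v (TwinRegion.hole R)

  twin₁ twin₂ : {t : Tree S} → Part t → Pos t
  twin₁ (v , R) = embed v (TwinRegion.b R)
  twin₂ (v , R) = embed v (TwinRegion.b′ R)

  member-twin₁ : {t : Tree S} (P : Part t) → member P (twin₁ P) ≡ true
  member-twin₁ (v , R) = trans (region-embed v hole b) (cong not b-outside)
    where open TwinRegion R

  member-twin₂ : {t : Tree S} (P : Part t) → member P (twin₂ P) ≡ true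
  member-twin₂ (v , R) = trans (region-embed v hole b′) (cong not b′-outside)
    where open TwinRegion R

  twins-distinct : {t : Tree S} (P : Part t) → twin₁ P ≢ twin₂ P
  twins-distinct (v , R) e = TwinRegion.distinct R (embed-injective v e)

  pebbles : {t : Tree S} → Vec (Pos t) (suc r) → Pos t → S → Σ[ S ] (suc r)
  pebbles vs u x = x , Vec.map (λ w → isYes (u ≟P w)) vs

  swap-twins : (t : Tree S) (P : Part t) (a : Vec (Pos t) r) → (∀ k → member P (lookup a k) ≡ false) →
               runRoot A (pebble t (a ∷ʳ twin₁ P)) ≡ runRoot A (pebble t (a ∷ʳ twin₂ P))
  swap-twins t P@(v , R) a avoid =
    run-local t v hole (pebbles (a ∷ʳ twin₁ P)) (pebbles (a ∷ʳ twin₂ P)) outside within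
    where
    open TwinRegion R

    not-member : {u w : Pos t} → member P u ≡ false → member P w ≡ true → u ≢ w
    not-member u∉ w∈ refl with () ← trans (sym u∉) w∈

    -- Outside the region only the pebbles a are seen, identically on both sides.
    outside : ∀ u → region v hole u ≡ false → ∀ x →
              pebbles (a ∷ʳ twin₁ P) u x ≡ pebbles (a ∷ʳ twin₂ P) u x
    outside u u∉ x = cong (x ,_) (begin
      Vec.map φ (a ∷ʳ twin₁ P)              ≡⟨ map-∷ʳ φ (twin₁ P) a ⟩
      Vec.map φ a ∷ʳ isYes (u ≟P twin₁ P) ≡⟨ cong (Vec.map φ a ∷ʳ_) (isYes-≢ u _ (not-member u∉ (member-twin₁ P))) ⟩
      Vec.map φ a ∷ʳ false                ≡⟨ cong (Vec.map φ a ∷ʳ_) (isYes-≢ u _ (not-member u∉ (member-twin₂ P))) ⟨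
      Vec.map φ a ∷ʳ isYes (u ≟P twin₂ P) ≡⟨ map-∷ʳ φ (twin₂ P) a ⟨
      Vec.map φ (a ∷ʳ twin₂ P)              ∎)
      where
      open ≡-Reasoning
      φ = λ w → isYes (u ≟P w)

    -- Inside the region the pebbles a are absent, so the labelling is lastPebble.
    restrict : (c p : Pos (subtree t v)) → below hole p ≡ false → ∀ x →
               pebbles (a ∷ʳ embed v c) (embed v p) x ≡ lastPebble c p x
    restrict c p p-outside x = cong (x ,_) (begin
      Vec.map φ (a ∷ʳ embed v c)                        ≡⟨ map-∷ʳ φ (embed v c) a ⟩
      Vec.map φ a ∷ʳ isYes (embed v p ≟P embed v c)     ≡⟨ cong₂ _∷ʳ_ (no-pebbles (embed v p) a avoids) (embed-isYes c) ⟩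
      replicate r false ∷ʳ isYes (p ≟P c)              ∎)
      where
      open ≡-Reasoning
      φ = λ w → isYes (embed v p ≟P w)
      p-member : member P (embed v p) ≡ true
      p-member = trans (region-embed v hole p) (cong not p-outside)
      avoids : ∀ k → embed v p ≢ lookup a k
      avoids k = not-member (avoid k) p-member ∘′ sym
      embed-isYes : (c : Pos (subtree t v)) → isYes (embed v p ≟P embed v c) ≡ isYes (p ≟P c)
      embed-isYes c with p ≟P c
      ... | yes refl = isYes-refl (embed v p)
      ... | no  p≢c  = isYes-≢ (embed v p) (embed v c) (p≢c ∘′ embed-injective v)

    within : ∀ q → behaviour (subtree t v) (λ p → pebbles (a ∷ʳ twin₁ P) (embed v p)) hole q
                 ≡ behaviour (subtree t v) (λ p → pebbles (a ∷ʳ twin₂ P) (embed v p)) hole q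
    within q = begin
      behaviour (subtree t v) (λ p → pebbles (a ∷ʳ twin₁ P) (embed v p)) hole q ≡⟨ behaviour-cong _ _ _ hole q (restrict b) ⟩
      behaviour (subtree t v) (lastPebble b) hole q                               ≡⟨ same-behaviour q ⟩
      behaviour (subtree t v) (lastPebble b′) hole q                              ≡⟨ behaviour-cong _ _ _ hole q (restrict b′) ⟨
      behaviour (subtree t v) (λ p → pebbles (a ∷ʳ twin₂ P) (embed v p)) hole q ∎
      where open ≡-Reasoning

module ListFacts where
  open import Data.Fin using (zero; suc)
  open import Data.Fin.Properties using (pigeonhole; <⇒≢)
  open import Data.List.Relation.Unary.Any using (here; there)

  everywhere : {X : Set} {P : X → Set} → (∀ x → P x) → (xs : List X) → All P xs
  everywhere p xs = All.tabulate (λ {x} _ → p x)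

  count : {X : Set} → (X → Bool) → List X → ℕ
  count p []       = 0
  count p (x ∷ xs) with p x
  ... | true  = suc (count p xs)
  ... | false = count p xs

  count-true : {X : Set} (xs : List X) → count (λ _ → true) xs ≡ length xs
  count-true []       = refl
  count-true (x ∷ xs) = cong suc (count-true xs)

  count-false : {X : Set} (p : X → Bool) → (∀ x → p x ≡ false) → (xs : List X) → count p xs ≡ 0
  count-false p never []       = refl
  count-false p never (x ∷ xs) rewrite never x = count-false p never xs

  module _ {X Z : Set} (f : X → Maybe Z) (g : Z → X) (retract : ∀ x z → f x ≡ just z → g z ≡ x) where

    length-mapMaybe : (p : X → Bool) → (∀ x → p x ≡ is-just (f x)) → (xs : List X) →
                      count p xs ≡ length (mapMaybe f xs)
    length-mapMaybe p domain [] = refl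
    length-mapMaybe p domain (x ∷ xs) rewrite domain x with f x
    ... | just _  = cong suc (length-mapMaybe p domain xs)
    ... | nothing = length-mapMaybe p domain xs

    ∈-mapMaybe : {z : Z} (xs : List X) → z ∈ mapMaybe f xs → g z ∈ xs
    ∈-mapMaybe (x ∷ xs) z∈ with f x in fx
    ∈-mapMaybe (x ∷ xs) (here refl) | just z = here (retract x z fx)
    ∈-mapMaybe (x ∷ xs) (there z∈)  | just _ = there (∈-mapMaybe xs z∈)
    ∈-mapMaybe (x ∷ xs) z∈          | nothing = there (∈-mapMaybe xs z∈)

    unique-mapMaybe : {xs : List X} → Unique xs → Unique (mapMaybe f xs)
    unique-mapMaybe [] = []
    unique-mapMaybe {x ∷ xs} (x∉ ∷ xs!) with f x in fx
    ... | just z  = All.tabulate (λ w∈ z≡w → All.lookup x∉ (∈-mapMaybe xs w∈)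
                                             (trans (sym (retract x z fx)) (cong g z≡w)))
                    ∷ unique-mapMaybe xs!
    ... | nothing = unique-mapMaybe xs!

  unique-constant : {X : Set} {x₀ : X} {xs : List X} → Unique xs → All (_≡ x₀) xs → length xs ≤ 1
  unique-constant []                 []                 = z≤n
  unique-constant (_ ∷ _)            (_ ∷ [])           = s≤s z≤n
  unique-constant ((x≢y ∷ _) ∷ _)    (refl ∷ refl ∷ _)  = ⊥-elim (x≢y refl)

  cross : {X : Set} {P Q : X → Set} {R : X → X → Set} {xs ys : List X} → All P xs → All Q ys →
          (∀ {x y} → P x → Q y → R x y) → All (λ x → All (R x) ys) xs
  cross []       qs rel = []
  cross (p ∷ ps) qs rel = All.map (rel p) qs ∷ cross ps qs rel

  allPairs-lookup : {X : Set} {R : X → X → Set} → (∀ {x y} → R x y → R y x) → {xs : List X} →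
                    AllPairs R xs → (i j : Fin (length xs)) → i ≢ j → R (List.lookup xs i) (List.lookup xs j)
  allPairs-lookup sym-R (x~ ∷ xs~) zero    zero    i≢j = ⊥-elim (i≢j refl)
  allPairs-lookup sym-R (x~ ∷ xs~) zero    (suc j) i≢j = All.lookup x~ (∈-lookup j)
  allPairs-lookup sym-R (x~ ∷ xs~) (suc i) zero    i≢j = sym-R (All.lookup x~ (∈-lookup i))
  allPairs-lookup sym-R (x~ ∷ xs~) (suc i) (suc j) i≢j = allPairs-lookup sym-R xs~ i j (i≢j ∘ cong suc)

  pigeonhole-list : {X : Set} {N : ℕ} (xs : List X) → Unique xs → (colour : X → Fin N) → N < length xs →
                    Σ X λ x → Σ X λ y → x ∈ xs × y ∈ xs × x ≢ y × colour x ≡ colour y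
  pigeonhole-list xs xs! colour N<len with pigeonhole N<len (λ i → colour (List.lookup xs i))
  ... | i , j , i<j , same = List.lookup xs i , List.lookup xs j , ∈-lookup i , ∈-lookup j
                           , allPairs-lookup (λ x≢y → x≢y ∘ sym) xs! i j (<⇒≢ i<j) , same

open ListFacts

-- Budget arithmetic of the decomposition.  Throughout, c is the credit of a
-- hole and c + c the cost of a part; y counts nodes, j credits, P parts and
-- e pending nodes.
module Budget where
  open import Data.Nat.Properties

  budget-merge : ∀ h cL cR jL jR c pL pR eL eR → cL + jL ≤ c * pL + eL → cR + jR ≤ c * pR + eR →
                 h + cL + cR + (jL + jR) ≤ c * (pL + pR) + (h + (eL + eR))
  budget-merge h cL cR jL jR c pL pR eL eR left right =
    subst₂ _≤_ (regroup-lhs h cL cR jL jR) (regroup-rhs h c pL pR eL eR) (+-monoʳ-≤ h (+-mono-≤ left right))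
    where
    regroup-lhs : ∀ h cL cR jL jR → h + ((cL + jL) + (cR + jR)) ≡ h + cL + cR + (jL + jR)
    regroup-lhs = solve-∀
    regroup-rhs : ∀ h c pL pR eL eR → h + ((c * pL + eL) + (c * pR + eR)) ≡ c * (pL + pR) + (h + (eL + eR))
    regroup-rhs = solve-∀

  -- Emitting a part pays for the fewer than c dropped pending nodes and for the
  -- credit c of the new hole.
  budget-emit : ∀ y j c P e → y + j ≤ (c + c) * P + e → e < c → y + c ≤ (c + c) * suc P + 0
  budget-emit y j c P e budget e<c = begin
    y + c                     ≤⟨ +-monoˡ-≤ c (≤-trans (m≤m+n y j) budget) ⟩
    (c + c) * P + e + c       ≤⟨ +-monoˡ-≤ c (+-monoʳ-≤ ((c + c) * P) (<⇒≤ e<c)) ⟩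
    (c + c) * P + c + c       ≡⟨ regroup c P ⟩
    (c + c) * suc P + 0       ∎
    where
    open ≤-Reasoning
    regroup : ∀ c P → (c + c) * P + c + c ≡ (c + c) * suc P + 0
    regroup = solve-∀

  -- Two holes merging into one: the surplus credit c pays for the fewer than c
  -- dropped pending nodes.
  budget-join : ∀ y c P e → y + (c + c) ≤ (c + c) * P + e → e < c → y + c ≤ (c + c) * P + 0
  budget-join y c P e budget e<c = +-cancelʳ-≤ c _ _ (<⇒≤ (begin-strict
    y + c + c             ≡⟨ +-assoc y c c ⟩
    y + (c + c)           ≤⟨ budget ⟩
    (c + c) * P + e       <⟨ +-monoʳ-< ((c + c) * P) e<c ⟩
    (c + c) * P + c       ≡⟨ cong (_+ c) (+-identityʳ _) ⟨
    (c + c) * P + 0 + c   ∎))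
    where open ≤-Reasoning

  pending-merge : ∀ h eL eR K → h ≤ 1 → eL < K → eR < K → h + (eL + eR) < K + K
  pending-merge h eL eR K h≤1 eL<K eR<K = begin-strict
    h + (eL + eR)         ≤⟨ +-monoˡ-≤ (eL + eR) h≤1 ⟩
    1 + (eL + eR)         <⟨ n<1+n _ ⟩
    suc (suc (eL + eR))   ≡⟨ cong suc (+-suc eL eR) ⟨
    suc eL + suc eR       ≤⟨ +-mono-≤ eL<K eR<K ⟩
    K + K                 ∎
    where open ≤-Reasoning

  nodes-bound : ∀ y j c P e K → y + j ≤ c * P + e → e < K → K ≤ c → y < suc P * c
  nodes-bound y j c P e K budget e<K K≤c = begin-strict
    y             ≤⟨ ≤-trans (m≤m+n y j) budget ⟩
    c * P + e     <⟨ +-monoʳ-< (c * P) (<-≤-trans e<K K≤c) ⟩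
    c * P + c     ≡⟨ regroup c P ⟩
    suc P * c     ∎
    where
    open ≤-Reasoning
    regroup : ∀ c P → c * P + c ≡ suc P * c
    regroup = solve-∀

open Budget

module Decomposition {S : Set} {r m : ℕ} (A : Automaton (Σ[ S ] (suc r)) m) where
  open Runs {S = S} A
  open Twins A

  -- M behaviours Fin m → Fin m exist, so any K = M + 1 candidate nodes
  -- contain a twin pair.  A hole carries a credit c₂, a part costs c₄.
  M K c₂ c₄ : ℕ
  M  = m ^ m
  K  = suc M
  c₂ = K + K
  c₄ = c₂ + c₂

  credit : {X : Set} → Maybe X → ℕ
  credit nothing  = 0
  credit (just _) = c₂

  HoleIn : {t : Tree S} → (Pos t → Bool) → Maybe (Pos t) → Set
  HoleIn scope nothing  = ⊤
  HoleIn scope (just h) = scope h ≡ true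

  Disjoint : {t : Tree S} → Part t → Part t → Set
  Disjoint P Q = ∀ u → member P u ≡ true → member Q u ≡ true → ⊥

  everything : {t : Tree S} → Pos t → Bool
  everything _ = true

  -- A partial decomposition of the nodes of t in the given scope (all of t, or
  -- one side of its root, whose nodes are those satisfying scope).  The region
  -- below the hole is exhausted: it contains all parts found so far.
  record Partial (t : Tree S) (Y : List (Pos t)) (scope : Pos t → Bool) (bound : ℕ) : Set where
    field
      parts           : List (Part t)
      hole            : Maybe (Pos t)
      pending         : List (Pos t)
      parts-below     : All (λ P → ∀ u → member P u ≡ true → below hole u ≡ true) parts
      parts-scope     : All (λ P → ∀ u → member P u ≡ true → scope u ≡ true) parts
      parts-Y         : All (λ P → twin₁ P ∈ Y × twin₂ P ∈ Y) parts
      parts-disjoint  : AllPairs Disjoint parts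
      pending-unique  : Unique pending
      pending-Y       : All (_∈ Y) pending
      pending-outside : All (λ u → below hole u ≡ false) pending
      pending-scope   : All (λ u → scope u ≡ true) pending
      hole-scope      : HoleIn scope hole
      few-pending     : length pending < bound
      budget          : count scope Y + credit hole ≤ c₄ * length parts + length pending

  -- The behaviour of the region of t above the hole, with the last pebble on
  -- b, encoded as one of the M functions Fin m → Fin m.
  behaviour-code : (t : Tree S) → Maybe (Pos t) → Pos t → Fin M
  behaviour-code t hole b = funToFin (behaviour t (lastPebble b) hole)

  code-injective : (t : Tree S) (hole : Maybe (Pos t)) (b b′ : Pos t) →
                   behaviour-code t hole b ≡ behaviour-code t hole b′ →
                   ∀ q → behaviour t (lastPebble b) hole q ≡ behaviour t (lastPebble b′) hole q
  code-injective t hole b b′ same q = begin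
    behaviour t (lastPebble b) hole q                           ≡⟨ finToFun-funToFin _ q ⟨
    finToFun (behaviour-code t hole b) q                        ≡⟨ cong (λ k → finToFun k q) same ⟩
    finToFun (behaviour-code t hole b′) q                       ≡⟨ finToFun-funToFin _ q ⟩
    behaviour t (lastPebble b′) hole q                          ∎
    where open ≡-Reasoning

  rebound : {t : Tree S} {Y : List (Pos t)} {scope : Pos t → Bool} {b b′ : ℕ} →
            (D : Partial t Y scope b) → length (Partial.pending D) < b′ → Partial t Y scope b′
  rebound D few = record
    { parts = parts ; hole = hole ; pending = pending
    ; parts-below = parts-below ; parts-scope = parts-scope ; parts-Y = parts-Y ; parts-disjoint = parts-disjoint
    ; pending-unique = pending-unique ; pending-Y = pending-Y ; pending-outside = pending-outside
    ; pending-scope = pending-scope ; hole-scope = hole-scope ; few-pending = few ; budget = budget }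
    where open Partial D

  emit : {a : S} {l r : Child S} {Y : List (Pos (node a l r))} →
         (D : Partial (node a l r) Y everything c₂) → K ≤ length (Partial.pending D) →
         Partial (node a l r) Y everything K
  emit {a} {l} {r} {Y} D many
    with b , b′ , b∈ , b′∈ , b≢b′ , same ← pigeonhole-list (Partial.pending D) (Partial.pending-unique D)
                                             (behaviour-code (node a l r) (Partial.hole D)) many
    = record
    { parts           = new ∷ D.parts
    ; hole            = just here
    ; pending         = []
    ; parts-below     = (λ _ _ → refl) ∷ everywhere (λ _ _ _ → refl) D.parts
    ; parts-scope     = everywhere (λ _ _ _ → refl) (new ∷ D.parts)
    ; parts-Y         = (All.lookup D.pending-Y b∈ , All.lookup D.pending-Y b′∈) ∷ D.parts-Y
    ; parts-disjoint  = All.map (λ below-hole u u∈new u∈Q → not-both (below D.hole u) u∈new (below-hole u u∈Q))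
                                D.parts-below
                        ∷ D.parts-disjoint
    ; pending-unique  = []
    ; pending-Y       = []
    ; pending-outside = []
    ; pending-scope   = []
    ; hole-scope      = refl
    ; few-pending     = s≤s z≤n
    ; budget          = budget-emit (count everything Y) (credit D.hole) c₂ (length D.parts) (length D.pending)
                                    D.budget D.few-pending
    }
    where
    module D = Partial D
    T = node a l r
    not-both : (x : Bool) → not x ≡ true → x ≡ true → ⊥
    not-both true () _
    new : Part T
    new = here , record
      { hole = D.hole ; b = b ; b′ = b′
      ; b-outside = All.lookup D.pending-outside b∈ ; b′-outside = All.lookup D.pending-outside b′∈
      ; distinct = b≢b′ ; same-behaviour = code-injective T D.hole b b′ same }

  close : {a : S} {l r : Child S} {Y : List (Pos (node a l r))} →
          Partial (node a l r) Y everything c₂ → Partial (node a l r) Y everything K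
  close D with K ≤? length (Partial.pending D)
  ... | no  few  = rebound D (≰⇒> few)
  ... | yes many = emit D many

  onLeft onRight : {t : Tree S} → Pos t → Bool
  onLeft here    = false
  onLeft (goL _) = true
  onLeft (goR _) = false
  onRight here    = false
  onRight (goL _) = false
  onRight (goR _) = true

  atRoot : {a : S} {l r : Child S} (u : Pos (node a l r)) → Dec (u ≡ here)
  atRoot u = u ≟P here

  count-sides : {a : S} {l r : Child S} (Y : List (Pos (node a l r))) →
                count everything Y ≡ length (filter atRoot Y) + count onLeft Y + count onRight Y
  count-sides []          = refl
  count-sides (here  ∷ Y) = cong suc (count-sides Y)
  count-sides (goL _ ∷ Y) = trans (cong suc (count-sides Y)) (cong (_+ count onRight Y) (sym (+-suc _ _)))
  count-sides (goR _ ∷ Y) = trans (cong suc (count-sides Y)) (sym (+-suc _ (count onRight Y)))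

  separated : {t : Tree S} (p : Pos t → Bool) {u v : Pos t} → p u ≡ true → p v ≡ false → u ≢ v
  separated p pu pv refl with () ← trans (sym pu) pv

  left-not-right : {t : Tree S} (u : Pos t) → onLeft u ≡ true → onRight u ≡ false
  left-not-right (goL _) _ = refl

  right-not-left : {t : Tree S} (u : Pos t) → onRight u ≡ true → onLeft u ≡ false
  right-not-left (goR _) _ = refl

  below-left : {t : Tree S} (h u : Pos t) → onLeft h ≡ true → onLeft u ≡ false → below (just h) u ≡ false
  below-left (goL (inside _)) here    _ _ = refl
  below-left (goL (inside _)) (goR _) _ _ = refl

  below-right : {t : Tree S} (h u : Pos t) → onRight h ≡ true → onRight u ≡ false → below (just h) u ≡ false
  below-right (goR (inside _)) here    _ _ = refl
  below-right (goR (inside _)) (goL _) _ _ = refl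

  -- Parts and pending
  -- nodes are concatenated (the root joins the pending nodes if it is in Y);
  -- of the holes of the two sides, the merged decomposition keeps the one
  -- present, or makes the root the hole when both are.
  module Merge {a : S} {l r : Child S} {Y : List (Pos (node a l r))} (Y! : Unique Y)
               (L : Partial (node a l r) Y onLeft K) (R : Partial (node a l r) Y onRight K) where
    private
      module L = Partial L
      module R = Partial R

    parts : List (Part (node a l r))
    parts = L.parts ++ R.parts

    parts-Y : All (λ P → twin₁ P ∈ Y × twin₂ P ∈ Y) parts
    parts-Y = All.++⁺ L.parts-Y R.parts-Y

    parts-disjoint : AllPairs Disjoint parts
    parts-disjoint = AllPairs.++⁺ L.parts-disjoint R.parts-disjoint
      (cross L.parts-scope R.parts-scope
        (λ left right u u∈P u∈Q → separated onRight (right u u∈Q) (left-not-right u (left u u∈P)) refl))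

    root : List (Pos (node a l r))
    root = filter atRoot Y

    root-here : All (_≡ here) root
    root-here = All.all-filter atRoot Y

    pending : List (Pos (node a l r))
    pending = root ++ (L.pending ++ R.pending)

    pending-unique : Unique pending
    pending-unique = Unique.++⁺ (Unique.filter⁺ atRoot Y!)
      (AllPairs.++⁺ L.pending-unique R.pending-unique
        (cross L.pending-scope R.pending-scope (λ {x} {y} x-left y-right → separated onLeft x-left (right-not-left y y-right))))
      (λ (x∈root , x∈sides) → All.lookup sides-not-root x∈sides (All.lookup root-here x∈root))
      where
      sides-not-root : All (_≢ here) (L.pending ++ R.pending)
      sides-not-root = All.++⁺ (All.map (λ x-left → separated onLeft x-left refl) L.pending-scope)
                               (All.map (λ x-right → separated onRight x-right refl) R.pending-scope)

    pending-Y : All (_∈ Y) pending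
    pending-Y = All.++⁺ (All.tabulate (λ x∈root → proj₁ (∈-filter⁻ atRoot x∈root)))
                        (All.++⁺ L.pending-Y R.pending-Y)

    few-pending : length pending < c₂
    few-pending = subst (_< c₂) (sym (trans (length-++ root) (cong (length root +_) (length-++ L.pending))))
      (pending-merge (length root) (length L.pending) (length R.pending) K
        (unique-constant (Unique.filter⁺ atRoot Y!) root-here) L.few-pending R.few-pending)

    budget : count everything Y + (credit L.hole + credit R.hole) ≤ c₄ * length parts + length pending
    budget = subst₂ _≤_
      (cong (_+ (credit L.hole + credit R.hole)) (sym (count-sides Y)))
      (cong₂ (λ p e → c₄ * p + e) (sym (length-++ L.parts))
                                  (sym (trans (length-++ root) (cong (length root +_) (length-++ L.pending)))))
      (budget-merge (length root) (count onLeft Y) (count onRight Y) (credit L.hole) (credit R.hole) c₄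
                    (length L.parts) (length R.parts) (length L.pending) (length R.pending) L.budget R.budget)

    private
      false≢true : false ≡ true → ⊥
      false≢true ()

    merged : Partial (node a l r) Y everything c₂
    merged = by-holes L.hole R.hole refl refl
      where
      by-holes : (hL hR : Maybe (Pos (node a l r))) → L.hole ≡ hL → R.hole ≡ hR → Partial (node a l r) Y everything c₂
      by-holes nothing nothing refl refl = record
        { parts = parts ; hole = nothing ; pending = pending
        ; parts-below = All.++⁺ L.parts-below R.parts-below ; parts-scope = everywhere (λ _ _ _ → refl) parts
        ; parts-Y = parts-Y ; parts-disjoint = parts-disjoint
        ; pending-unique = pending-unique ; pending-Y = pending-Y ; pending-outside = everywhere (λ _ → refl) pending
        ; pending-scope = everywhere (λ _ → refl) pending ; hole-scope = tt ; few-pending = few-pending ; budget = budget }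
      by-holes (just h) nothing refl refl = record
        { parts = parts ; hole = just h ; pending = pending
        ; parts-below = All.++⁺ L.parts-below (All.map (λ inside u u∈P → ⊥-elim (false≢true (inside u u∈P))) R.parts-below)
        ; parts-scope = everywhere (λ _ _ _ → refl) parts
        ; parts-Y = parts-Y ; parts-disjoint = parts-disjoint
        ; pending-unique = pending-unique ; pending-Y = pending-Y
        ; pending-outside = All.++⁺ (All.map (λ { refl → below-left h here L.hole-scope refl }) root-here)
            (All.++⁺ L.pending-outside (All.map (λ {u} u-right → below-left h u L.hole-scope (right-not-left u u-right)) R.pending-scope))
        ; pending-scope = everywhere (λ _ → refl) pending ; hole-scope = refl ; few-pending = few-pending
        ; budget = subst (λ j → count everything Y + j ≤ c₄ * length parts + length pending) (+-identityʳ c₂) budget }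
      by-holes nothing (just h) refl refl = record
        { parts = parts ; hole = just h ; pending = pending
        ; parts-below = All.++⁺ (All.map (λ inside u u∈P → ⊥-elim (false≢true (inside u u∈P))) L.parts-below) R.parts-below
        ; parts-scope = everywhere (λ _ _ _ → refl) parts
        ; parts-Y = parts-Y ; parts-disjoint = parts-disjoint
        ; pending-unique = pending-unique ; pending-Y = pending-Y
        ; pending-outside = All.++⁺ (All.map (λ { refl → below-right h here R.hole-scope refl }) root-here)
            (All.++⁺ (All.map (λ {u} u-left → below-right h u R.hole-scope (left-not-right u u-left)) L.pending-scope) R.pending-outside)
        ; pending-scope = everywhere (λ _ → refl) pending ; hole-scope = refl ; few-pending = few-pending ; budget = budget }
      by-holes (just _) (just _) refl refl = record
        { parts = parts ; hole = just here ; pending = []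
        ; parts-below = everywhere (λ _ _ _ → refl) parts ; parts-scope = everywhere (λ _ _ _ → refl) parts
        ; parts-Y = parts-Y ; parts-disjoint = parts-disjoint
        ; pending-unique = [] ; pending-Y = [] ; pending-outside = [] ; pending-scope = [] ; hole-scope = refl
        ; few-pending = s≤s z≤n
        ; budget = budget-join (count everything Y) c₂ (length parts) (length pending) budget few-pending }

  record ChildEmbedding (T c : Tree S) (scope : Pos T → Bool) : Set where
    field
      inj          : Pos c → Pos T
      proj         : Pos T → Maybe (Pos c)
      liftPart     : Part c → Part T
      proj-inj     : ∀ z → proj (inj z) ≡ just z
      inj-proj     : ∀ x z → proj x ≡ just z → inj z ≡ x
      scope-proj   : ∀ x → scope x ≡ is-just (proj x)
      below-inj    : ∀ h u → below (just (inj h)) (inj u) ≡ below (just h) u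
      member-inj   : ∀ P z → member (liftPart P) (inj z) ≡ member P z
      member-scope : ∀ P x → member (liftPart P) x ≡ true → scope x ≡ true
      twin₁-inj    : ∀ P → twin₁ (liftPart P) ≡ inj (twin₁ P)
      twin₂-inj    : ∀ P → twin₂ (liftPart P) ≡ inj (twin₂ P)

  module Lift {T c : Tree S} {scope : Pos T → Bool} (E : ChildEmbedding T c scope) where
    open ChildEmbedding E

    from-scope : ∀ x → scope x ≡ true → Σ (Pos c) λ z → inj z ≡ x
    from-scope x in-scope with proj x in proj-x
    ... | just z  = z , inj-proj x z proj-x
    ... | nothing with () ← trans (trans (sym in-scope) (scope-proj x)) (cong is-just proj-x)

    scope-inj : ∀ z → scope (inj z) ≡ true
    scope-inj z = trans (scope-proj (inj z)) (cong is-just (proj-inj z))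

    inj-injective : ∀ {z w} → inj z ≡ inj w → z ≡ w
    inj-injective {z} {w} e = just-injective (trans (sym (proj-inj z)) (trans (cong proj e) (proj-inj w)))
      where
      just-injective : {x y : Pos c} → just x ≡ just y → x ≡ y
      just-injective refl = refl

    below-lift : ∀ hole z → below (Maybe.map inj hole) (inj z) ≡ below hole z
    below-lift nothing  z = refl
    below-lift (just h) z = below-inj h z

    credit-lift : ∀ (hole : Maybe (Pos c)) → credit (Maybe.map inj hole) ≡ credit hole
    credit-lift nothing  = refl
    credit-lift (just _) = refl

    hole-lift : ∀ (hole : Maybe (Pos c)) → HoleIn scope (Maybe.map inj hole)
    hole-lift nothing  = tt
    hole-lift (just h) = scope-inj h

    on-members : (P : Part c) {Q : Pos T → Set} → (∀ z → member P z ≡ true → Q (inj z)) →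
                 ∀ x → member (liftPart P) x ≡ true → Q x
    on-members P q x x∈P with z , refl ← from-scope x (member-scope P x x∈P) =
      q z (trans (sym (member-inj P z)) x∈P)

    lift : (Y : List (Pos T)) → Partial c (mapMaybe proj Y) everything K → Partial T Y scope K
    lift Y D = record
      { parts           = map liftPart D.parts
      ; hole            = Maybe.map inj D.hole
      ; pending         = map inj D.pending
      ; parts-below     = All.map⁺ (All.map (λ {P} inside → on-members P (λ z z∈P →
                                      trans (below-lift D.hole z) (inside z z∈P))) D.parts-below)
      ; parts-scope     = All.map⁺ (everywhere member-scope D.parts)
      ; parts-Y         = All.map⁺ (All.map (λ {P} (b∈ , b′∈) →
                            subst (_∈ Y) (sym (twin₁-inj P)) (in-Y b∈) , subst (_∈ Y) (sym (twin₂-inj P)) (in-Y b′∈))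
                            D.parts-Y)
      ; parts-disjoint  = AllPairs.map⁺ (AllPairs.map (λ {P} {Q} disjoint → on-members P (λ z z∈P z∈Q →
                            disjoint z z∈P (trans (sym (member-inj Q z)) z∈Q))) D.parts-disjoint)
      ; pending-unique  = Unique.map⁺ inj-injective D.pending-unique
      ; pending-Y       = All.map⁺ (All.map in-Y D.pending-Y)
      ; pending-outside = All.map⁺ (All.map (λ {z} outside → trans (below-lift D.hole z) outside) D.pending-outside)
      ; pending-scope   = All.map⁺ (everywhere scope-inj D.pending)
      ; hole-scope      = hole-lift D.hole
      ; few-pending     = subst (_< K) (sym (length-map inj D.pending)) D.few-pending
      ; budget          = subst₂ _≤_
          (cong₂ _+_ (trans (count-true (mapMaybe proj Y)) (sym (length-mapMaybe proj inj inj-proj scope scope-proj Y)))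
                     (sym (credit-lift D.hole)))
          (cong₂ (λ p e → c₄ * p + e) (sym (length-map liftPart D.parts)) (sym (length-map inj D.pending)))
          D.budget
      }
      where
      module D = Partial D
      in-Y : ∀ {z} → z ∈ mapMaybe proj Y → inj z ∈ Y
      in-Y = ∈-mapMaybe proj inj inj-proj Y

  open ChildEmbedding

  left-embedding : {a : S} {l : Tree S} {r : Child S} → ChildEmbedding (node a (some l) r) l onLeft
  left-embedding .inj u = goL (inside u)
  left-embedding .proj here             = nothing
  left-embedding .proj (goL (inside u)) = just u
  left-embedding .proj (goR _)          = nothing
  left-embedding .liftPart (v , R) = goL (inside v) , R
  left-embedding .proj-inj z = refl
  left-embedding .inj-proj (goL (inside u)) .u refl = refl
  left-embedding .scope-proj here    = refl
  left-embedding .scope-proj (goL (inside _)) = refl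
  left-embedding .scope-proj (goR _) = refl
  left-embedding .below-inj h u = refl
  left-embedding .member-inj (v , R) z = refl
  left-embedding .member-scope (v , R) (goL _) _ = refl
  left-embedding .twin₁-inj (v , R) = refl
  left-embedding .twin₂-inj (v , R) = refl

  right-embedding : {a : S} {l : Child S} {r : Tree S} → ChildEmbedding (node a l (some r)) r onRight
  right-embedding .inj u = goR (inside u)
  right-embedding .proj here             = nothing
  right-embedding .proj (goL _)          = nothing
  right-embedding .proj (goR (inside u)) = just u
  right-embedding .liftPart (v , R) = goR (inside v) , R
  right-embedding .proj-inj z = refl
  right-embedding .inj-proj (goR (inside u)) .u refl = refl
  right-embedding .scope-proj here    = refl
  right-embedding .scope-proj (goL _) = refl
  right-embedding .scope-proj (goR (inside _)) = refl
  right-embedding .below-inj h u = refl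
  right-embedding .member-inj (v , R) z = refl
  right-embedding .member-scope (v , R) (goR _) _ = refl
  right-embedding .twin₁-inj (v , R) = refl
  right-embedding .twin₂-inj (v , R) = refl

  empty : {t : Tree S} {scope : Pos t → Bool} → (∀ u → scope u ≡ false) → (Y : List (Pos t)) → Partial t Y scope K
  empty {scope = scope} never Y = record
    { parts = [] ; hole = nothing ; pending = []
    ; parts-below = [] ; parts-scope = [] ; parts-Y = [] ; parts-disjoint = []
    ; pending-unique = [] ; pending-Y = [] ; pending-outside = [] ; pending-scope = [] ; hole-scope = tt
    ; few-pending = s≤s z≤n
    ; budget = subst₂ _≤_ (sym (trans (+-identityʳ _) (count-false scope never Y))) (sym (+-identityʳ (c₄ * 0))) z≤n }

  mutual
    decompose : (t : Tree S) (Y : List (Pos t)) → Unique Y → Partial t Y everything K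
    decompose (node a l r) Y Y! = close (Merge.merged Y! (decompose-left a l r Y Y!) (decompose-right a l r Y Y!))

    decompose-left : (a : S) (l r : Child S) (Y : List (Pos (node a l r))) → Unique Y → Partial (node a l r) Y onLeft K
    decompose-left a none     r Y Y! = empty (λ { here → refl ; (goR _) → refl }) Y
    decompose-left a (some l) r Y Y! =
      Lift.lift left-embedding Y (decompose l (mapMaybe (proj left-embedding) Y)
        (unique-mapMaybe (proj left-embedding) (inj left-embedding) (inj-proj left-embedding) Y!))

    decompose-right : (a : S) (l r : Child S) (Y : List (Pos (node a l r))) → Unique Y → Partial (node a l r) Y onRight K
    decompose-right a l none     Y Y! = empty (λ { here → refl ; (goL _) → refl }) Y
    decompose-right a l (some r) Y Y! =
      Lift.lift right-embedding Y (decompose r (mapMaybe (proj right-embedding) Y)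
        (unique-mapMaybe (proj right-embedding) (inj right-embedding) (inj-proj right-embedding) Y!))

  enough-parts : {t : Tree S} {Y : List (Pos t)} (D : Partial t Y everything K) →
                 length Y / (4 + 4 * M) ≤ length (Partial.parts D)
  enough-parts {Y = Y} D = ≤-pred (m<n*o⇒m/o<n (subst (λ c → length Y < suc (length parts) * c) c₄-value few-nodes))
    where
    open Partial D
    c₄-value : c₄ ≡ 4 + 4 * M
    c₄-value = four-K M
      where
      four-K : ∀ M → (suc M + suc M) + (suc M + suc M) ≡ 4 + 4 * M
      four-K = solve-∀
    few-nodes : length Y < suc (length parts) * c₄
    few-nodes = nodes-bound (length Y) (credit hole) c₄ (length parts) (length pending) K
      (subst (λ y → y + credit hole ≤ c₄ * length parts + length pending) (count-true Y) budget)
      few-pending (≤-trans (m≤m+n K K) (m≤m+n c₂ c₂))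

lemma4 : (s r m : ℕ) (A : Automaton (Σ[ Fin s ] (suc r)) m)
           (t : Tree (Fin s)) (Y : List (Pos t)) → Unique Y
           → 2 * m ^ m + 2 ≤ length Y
           → let n = length Y / (4 + 4 * m ^ m) in
             Σ (Fin n → Pos t → Bool) λ V →
             Σ (Fin n → Pos t) λ b →
             Σ (Fin n → Pos t) λ b′ →
               (∀ i j u → i ≢ j → V i u ≡ true → V j u ≡ true → ⊥)
             × (∀ i → V i (b i) ≡ true × b i ∈ Y × V i (b′ i) ≡ true × b′ i ∈ Y × b i ≢ b′ i)
             × (∀ (a : Vec (Pos t) r) (i : Fin n)
                  → (∀ k → V i (lookup a k) ≡ false)
                  → runRoot A (pebble t (a ∷ʳ b i)) ≡ runRoot A (pebble t (a ∷ʳ b′ i)))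
lemma4 s r m A t Y Y! _ =
    (λ i → member (part i)) , (λ i → twin₁ (part i)) , (λ i → twin₂ (part i))
  , (λ i j u i≢j → allPairs-lookup (λ disjoint u u∈Q u∈P → disjoint u u∈P u∈Q) parts-disjoint
                      (index i) (index j) (λ e → i≢j (inject≤-injective _ _ i j e)) u)
  , (λ i → member-twin₁ (part i) , proj₁ (in-Y i) , member-twin₂ (part i) , proj₂ (in-Y i) , twins-distinct (part i))
  , (λ a i → swap-twins t (part i) a)
  where
  open Twins A
  open Decomposition A
  open Partial (decompose t Y Y!)
  index : Fin (length Y / (4 + 4 * m ^ m)) → Fin (length parts)
  index i = inject≤ i (enough-parts (decompose t Y Y!))
  part : Fin (length Y / (4 + 4 * m ^ m)) → Part t
  part i = List.lookup parts (index i)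
  in-Y : ∀ i → twin₁ (part i) ∈ Y × twin₂ (part i) ∈ Y
  in-Y i = All.lookup parts-Y (∈-lookup (index i))
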